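{- Let $k$ be a nonnegative integer, let $N,D,M$ be positive integers, and let $\mathrm{Disp}:[N]\times[D]\to[M]$ be a $(k,1/4)$-strong disperser. For $j\in[D]$ let $\mathcal{E}_j$ be the partial-assignment algorithm that places each worker $\omega$ in bin $\mathrm{Disp}(\omega,j)$ and each task $\tau$ in bin $\mathrm{Disp}(\tau,j)$, and in each bin $b\in[M]$ containing at least one (remaining) worker and at least one (remaining) task matches the smallest such worker to the smallest such task. Let $\widehat{\mathcal{E}}$ be the algorithm applying $\mathcal{E}_1,\mathcal{E}_2,\dots,\mathcal{E}_D$ in sequence. Then for every worker/task input $(W,T)$ with $W,T\subseteq[N]$ and $|W|=|T|\ge 2^k$, $\widehat{\mathcal{E}}(W,T)$ makes at least $M/4$ worker/task assignments.
   Context: A $(k,\epsilon)$-strong disperser is a function $\mathrm{Disp}:[N]\times[D]\to[M]$ such that for every $S\subseteq[N]$ with $|S|\ge 2^k$, $|\{(\mathrm{Disp}(s,d),d): s\in S, d\in[D]\}|\ge(1-\epsilon)MD$. A worker/task input is a pair $(W,T)$ of a set of workers and a set of tasks (here both subsets of $[N]$) with $|W|=|T|$; a partial-assignment algorithm matches some workers of $W$ to some tasks of $T$, and the unmatched ones form its output. Applying algorithms in sequence means each acts on the unmatched workers and tasks left by the previous ones; the number of assignments made is the total number of matched pairs. -}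

module Defs where

open import Data.Nat using (ℕ; zero; suc; _+_; _*_)
open import Data.Bool using (Bool; true; false; not; _∧_)
open import Data.Fin using (Fin; _≟_; _≤?_)
open import Data.Fin.Subset using (Subset; _∈_)
open import Data.Fin.Subset.Properties using (_∈?_)
open import Data.Fin.Properties using (any?; all?)
open import Data.Vec using (tabulate)
open import Data.List using (List; []; _∷_; allFin)
open import Data.Product using (_×_; _,_)
open import Relation.Nullary.Decidable using (⌊_⌋; _×-dec_; _→-dec_)

sumFin : (n : ℕ) → (Fin n → ℕ) → ℕ
sumFin zero    f = 0
sumFin (suc n) f = f Fin.zero + sumFin n (λ i → f (Fin.suc i))
  where import Data.Fin as Fin

image : {N M : ℕ} → (Fin N → Fin M) → Subset N → Subset M
image {N} f S = tabulate λ b → ⌊ any? (λ s → (s ∈? S) ×-dec (f s ≟ b)) ⌋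

-- |{(Disp(s,d),d) : s ∈ S, d ∈ [D]}|  (the set is the disjoint union over d
-- of the images at each seed d).
pairImageSize : {N D M : ℕ} → (Fin N → Fin D → Fin M) → Subset N → ℕ
pairImageSize {D = D} Disp S = sumFin D (λ d → Data.Fin.Subset.∣ image (λ s → Disp s d) S ∣)
  where import Data.Fin.Subset

-- (k, 1/4)-strong disperser: every S with |S| ≥ 2^k has
-- |{(Disp(s,d),d)}| ≥ (1 - 1/4) M D, i.e. 4·|...| ≥ 3·M·D.
IsStrongDisperser¼ : (k N D M : ℕ) → (Fin N → Fin D → Fin M) → Set
IsStrongDisperser¼ k N D M Disp =
  (S : Subset N) → 2 ^ k ≤ ∣ S ∣ → 3 * (M * D) ≤ 4 * pairImageSize Disp S
  where open import Data.Nat using (_^_; _≤_)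
        open import Data.Fin.Subset using (∣_∣)

module Alg {N D M : ℕ} (Disp : Fin N → Fin D → Fin M) where

  occupied : Fin D → Subset N → Fin M → Bool
  occupied j S b = ⌊ any? (λ x → (x ∈? S) ×-dec (Disp x j ≟ b)) ⌋

  smallestInBin : Fin D → Subset N → Fin N → Bool
  smallestInBin j S x = ⌊ (x ∈? S) ×-dec
      all? (λ y → (y ∈? S) →-dec ((Disp y j ≟ Disp x j) →-dec (x ≤? y))) ⌋

  matches : Fin D → Subset N → Subset N → ℕ
  matches j W T = Data.Fin.Subset.∣ tabulate (λ b → occupied j W b ∧ occupied j T b) ∣
    where import Data.Fin.Subset

  restW : Fin D → Subset N → Subset N → Subset N
  restW j W T = tabulate λ w →
    ⌊ w ∈? W ⌋ ∧ not (smallestInBin j W w ∧ occupied j T (Disp w j))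

  restT : Fin D → Subset N → Subset N → Subset N
  restT j W T = tabulate λ t →
    ⌊ t ∈? T ⌋ ∧ not (smallestInBin j T t ∧ occupied j W (Disp t j))

  runSeq : List (Fin D) → Subset N → Subset N → ℕ
  runSeq []       W T = 0
  runSeq (j ∷ js) W T = matches j W T + runSeq js (restW j W T) (restT j W T)

  -- Ê = E_1, …, E_D in order (allFin D lists seeds in increasing order).
  assignmentsÊ : Subset N → Subset N → ℕ
  assignmentsÊ W T = runSeq (allFin D) W T

-- Let A be the number of assignments, RW ⊆ W the matched workers and
-- RT ⊆ T the matched tasks, so |RW| = |RT| ≤ A.  Fix a seed d and write
-- bins_d(S) for the bins occupied by S at seed d.  Every bin occupied by
-- both W and T at seed d is occupied at seed d by RW or by RT: when round d
-- runs, either the bin still holds a worker and a task (and round d matches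
-- its least worker), or one of its original occupants was matched earlier.
-- By inclusion–exclusion and |bins_d(S)| ≤ |S|,
--   |bins_d(W)| + |bins_d(T)| ≤ M + |bins_d(RW)| + |bins_d(RT)| ≤ M + 2A.
-- Summing over d and using the disperser property for W and for T gives
-- 6MD/4 ≤ D(M + 2A), i.e. M ≤ 4A.
module Submission where

open import Defs
open import Data.Nat using (ℕ; _≤_; _<_; _*_; _^_)
open import Data.Fin using (Fin)
open import Data.Fin.Subset using (Subset; ∣_∣)
open import Relation.Binary.PropositionalEquality using (_≡_)

open import Data.Nat using (zero; suc; _+_; z≤n; s≤s)
open import Data.Nat.Properties
  using (≤-trans; ≤-reflexive; m≤m+n; +-suc; +-mono-≤; +-monoˡ-≤; +-monoʳ-≤; *-monoʳ-≤;
         +-cancelˡ-≤; *-cancelˡ-≤; *-distribˡ-+; +-commutativeSemigroup; module ≤-Reasoning)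
open import Data.Nat.Tactic.RingSolver using (solve-∀)
open import Data.Bool using (Bool; true; false; not; _∧_; T)
open import Data.Bool.Properties using (T-≡; T-∧; T?)
open import Data.Fin as Fin using (zero; suc)
open import Data.Fin.Properties using (suc-injective; 0≢1+n)
  renaming (≤-antisym to ≤ᶠ-antisym)
open import Data.Fin.Subset using (_∈_; _∉_; _⊆_; _∩_; _∪_; _─_; _-_; ⊥; ⁅_⁆)
open import Data.Fin.Subset.Properties
open import Data.Vec using ([]; _∷_; tabulate; here; there)
open import Data.Vec.Properties using (lookup∘tabulate; []=⇒lookup; lookup⇒[]=)
open import Data.List using (List; []; _∷_; allFin)
open import Data.List.Relation.Unary.Any using () renaming (here to hereₗ; there to thereₗ)
open import Data.List.Membership.Propositional using () renaming (_∈_ to _∈ₗ_)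
open import Data.List.Membership.Propositional.Properties using (∈-allFin)
open import Data.Product using (_×_; _,_; ∃; proj₁; proj₂)
open import Data.Sum using (_⊎_; inj₁; inj₂)
open import Function using (_∘_; _⇔_; Equivalence; mk⇔)
open import Relation.Nullary using (¬_; yes; no; contradiction)
open import Relation.Nullary.Decidable using (toWitness; fromWitness; _×-dec_)
open import Relation.Unary using (Pred; Decidable)
open import Relation.Binary.PropositionalEquality using (refl; sym; trans; cong; cong₂; subst; module ≡-Reasoning)
open import Algebra.Properties.CommutativeSemigroup +-commutativeSemigroup using (interchange)

open Equivalence using (to; from)

∈-tabulate : ∀ {n} (g : Fin n → Bool) {x : Fin n} → x ∈ tabulate g ⇔ T (g x)
∈-tabulate g {x} = mk⇔
  (λ x∈ → from T-≡ (trans (sym (lookup∘tabulate g x)) ([]=⇒lookup x∈)))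
  (λ t → lookup⇒[]= x (tabulate g) (trans (lookup∘tabulate g x) (to T-≡ t)))

tabulate-∧ : ∀ n (f g : Fin n → Bool) → tabulate (λ i → f i ∧ g i) ≡ tabulate f ∩ tabulate g
tabulate-∧ zero    f g = refl
tabulate-∧ (suc n) f g = cong (f zero ∧ g zero ∷_) (tabulate-∧ n (f ∘ suc) (g ∘ suc))

x∈p─q⇒x∉q : ∀ {n} (p q : Subset n) {x : Fin n} → x ∈ p ─ q → x ∉ q
x∈p─q⇒x∉q (_ ∷ p) (_     ∷ q) (there h) x∈q = x∈p─q⇒x∉q p q h (drop-there x∈q)
x∈p─q⇒x∉q (_ ∷ p) (false ∷ q) here      ()
x∈p─q⇒x∉q (_ ∷ p) (true  ∷ q) {zero} ()

─-mono : ∀ {n} {p p′ q q′ : Subset n} → p ⊆ p′ → q′ ⊆ q → p ─ q ⊆ p′ ─ q′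
─-mono {p = p} {q = q} p⊆p′ q′⊆q x∈ =
  x∈p∧x∉q⇒x∈p─q (p⊆p′ (p─q⊆p p q x∈)) (x∈p─q⇒x∉q p q x∈ ∘ q′⊆q)

─-split : ∀ {n} (p q r : Subset n) → p ─ r ⊆ (p ─ q) ∪ (q ─ r)
─-split p q r {x} x∈ with x ∈? q
... | yes x∈q = x∈p∪q⁺ (inj₂ (x∈p∧x∉q⇒x∈p─q x∈q (x∈p─q⇒x∉q p r x∈)))
... | no  x∉q = x∈p∪q⁺ (inj₁ (x∈p∧x∉q⇒x∈p─q (p─q⊆p p r x∈) x∉q))

∈-image⁺ : ∀ {n m} (f : Fin n → Fin m) {S : Subset n} {x : Fin n} → x ∈ S → f x ∈ image f S
∈-image⁺ f {x = x} x∈S = from (∈-tabulate _) (fromWitness (x , x∈S , refl))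

∈-image⁻ : ∀ {n m} (f : Fin n → Fin m) {S : Subset n} {b : Fin m} →
           b ∈ image f S → ∃ λ x → x ∈ S × f x ≡ b
∈-image⁻ f b∈ = toWitness (to (∈-tabulate _) b∈)

image-mono : ∀ {n m} (f : Fin n → Fin m) {S S′ : Subset n} → S ⊆ S′ → image f S ⊆ image f S′
image-mono f S⊆S′ b∈ with ∈-image⁻ f b∈
... | x , x∈S , refl = ∈-image⁺ f (S⊆S′ x∈S)

image-─ : ∀ {n m} (f : Fin n → Fin m) (S S′ : Subset n) →
          image f S ⊆ image f S′ ∪ image f (S ─ S′)
image-─ f S S′ b∈ with ∈-image⁻ f b∈
... | x , x∈S , refl with x ∈? S′
...   | yes x∈S′ = x∈p∪q⁺ (inj₁ (∈-image⁺ f x∈S′))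
...   | no  x∉S′ = x∈p∪q⁺ (inj₂ (∈-image⁺ f (x∈p∧x∉q⇒x∈p─q x∈S x∉S′)))

∣∪∣+∣∩∣ : ∀ {n} (p q : Subset n) → ∣ p ∪ q ∣ + ∣ p ∩ q ∣ ≡ ∣ p ∣ + ∣ q ∣
∣∪∣+∣∩∣ []          []          = refl
∣∪∣+∣∩∣ (false ∷ p) (false ∷ q) = ∣∪∣+∣∩∣ p q
∣∪∣+∣∩∣ (true  ∷ p) (false ∷ q) = cong suc (∣∪∣+∣∩∣ p q)
∣∪∣+∣∩∣ (false ∷ p) (true  ∷ q) = trans (cong suc (∣∪∣+∣∩∣ p q)) (sym (+-suc ∣ p ∣ ∣ q ∣))
∣∪∣+∣∩∣ (true  ∷ p) (true  ∷ q) =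
  cong suc (trans (+-suc ∣ p ∪ q ∣ ∣ p ∩ q ∣) (trans (cong suc (∣∪∣+∣∩∣ p q)) (sym (+-suc ∣ p ∣ ∣ q ∣))))

∣p∪q∣≤∣p∣+∣q∣ : ∀ {n} (p q : Subset n) → ∣ p ∪ q ∣ ≤ ∣ p ∣ + ∣ q ∣
∣p∪q∣≤∣p∣+∣q∣ p q = ≤-trans (m≤m+n ∣ p ∪ q ∣ ∣ p ∩ q ∣) (≤-reflexive (∣∪∣+∣∩∣ p q))

∣p∣+∣q∣≤n+∣p∩q∣ : ∀ {n} (p q : Subset n) → ∣ p ∣ + ∣ q ∣ ≤ n + ∣ p ∩ q ∣
∣p∣+∣q∣≤n+∣p∩q∣ p q = ≤-trans (≤-reflexive (sym (∣∪∣+∣∩∣ p q))) (+-monoˡ-≤ ∣ p ∩ q ∣ (∣p∣≤n (p ∪ q)))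

∣image∣≤ : ∀ {n m} (f : Fin n → Fin m) (S : Subset n) → ∣ image f S ∣ ≤ ∣ S ∣
∣image∣≤ {m = m} f []  = ≤-trans (p⊆q⇒∣p∣≤∣q∣ ⊥-image) (≤-reflexive (∣⊥∣≡0 m))
  where ⊥-image : ∀ {b} → b ∈ image f [] → b ∈ ⊥
        ⊥-image b∈ with ∈-image⁻ f {S = []} b∈
        ... | () , _
∣image∣≤ f (false ∷ S) = ≤-trans (p⊆q⇒∣p∣≤∣q∣ shrink) (∣image∣≤ (f ∘ suc) S)
  where shrink : image f (false ∷ S) ⊆ image (f ∘ suc) S
        shrink b∈ with ∈-image⁻ f b∈
        ... | suc x , there x∈S , refl = ∈-image⁺ (f ∘ suc) x∈S
∣image∣≤ f (true ∷ S)  = begin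
  ∣ image f (true ∷ S) ∣                ≤⟨ p⊆q⇒∣p∣≤∣q∣ shrink ⟩
  ∣ ⁅ f zero ⁆ ∪ image (f ∘ suc) S ∣    ≤⟨ ∣p∪q∣≤∣p∣+∣q∣ ⁅ f zero ⁆ _ ⟩
  ∣ ⁅ f zero ⁆ ∣ + ∣ image (f ∘ suc) S ∣ ≡⟨ cong (_+ ∣ image (f ∘ suc) S ∣) (∣⁅x⁆∣≡1 (f zero)) ⟩
  suc ∣ image (f ∘ suc) S ∣             ≤⟨ s≤s (∣image∣≤ (f ∘ suc) S) ⟩
  suc ∣ S ∣                             ∎
  where open ≤-Reasoning
        shrink : image f (true ∷ S) ⊆ ⁅ f zero ⁆ ∪ image (f ∘ suc) S
        shrink b∈ with ∈-image⁻ f b∈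
        ... | zero  , _          , refl = x∈p∪q⁺ (inj₁ (x∈⁅x⁆ (f zero)))
        ... | suc x , there x∈S , refl = x∈p∪q⁺ (inj₂ (∈-image⁺ (f ∘ suc) x∈S))

∣S∣≤∣R∣-by-injection : ∀ {n m} (f : Fin n → Fin m) (S : Subset n) {R : Subset m} →
  (∀ {x} → x ∈ S → f x ∈ R) → (∀ {x y} → x ∈ S → y ∈ S → f x ≡ f y → x ≡ y) → ∣ S ∣ ≤ ∣ R ∣
∣S∣≤∣R∣-by-injection f []          into inj = z≤n
∣S∣≤∣R∣-by-injection f (false ∷ S) into inj =
  ∣S∣≤∣R∣-by-injection (f ∘ suc) S (into ∘ there)
    (λ x∈ y∈ e → suc-injective (inj (there x∈) (there y∈) e))
∣S∣≤∣R∣-by-injection f (true ∷ S) {R} into inj =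
  ≤-trans (s≤s (∣S∣≤∣R∣-by-injection (f ∘ suc) S into-R-minus
                  (λ x∈ y∈ e → suc-injective (inj (there x∈) (there y∈) e))))
          (x∈p⇒∣p-x∣<∣p∣ (into here))
  where into-R-minus : ∀ {x} → x ∈ S → f (suc x) ∈ R - f zero
        into-R-minus x∈ = x∈p∧x≢y⇒x∈p-y (into (there x∈)) (0≢1+n ∘ sym ∘ inj (there x∈) here)

least-witness : ∀ {n p} (P : Pred (Fin n) p) → Decidable P → ∀ {x} → P x →
                ∃ λ w → P w × (∀ {y} → P y → w Fin.≤ y)
least-witness {suc n} P P? {x} Px with P? zero
... | yes P0 = zero , P0 , λ _ → z≤n
least-witness {suc n} P P? {zero}  Px | no ¬P0 = contradiction Px ¬P0
least-witness {suc n} P P? {suc x} Px | no ¬P0 with least-witness (P ∘ suc) (P? ∘ suc) Px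
... | w , Pw , least = suc w , Pw , least′
  where least′ : ∀ {y} → P y → suc w Fin.≤ y
        least′ {zero}  Py = contradiction Py ¬P0
        least′ {suc y} Py = s≤s (least Py)

sumFin-bound : ∀ n (f g : Fin n → ℕ) c → (∀ i → f i + g i ≤ c) → sumFin n f + sumFin n g ≤ n * c
sumFin-bound zero    f g c bound = z≤n
sumFin-bound (suc n) f g c bound = begin
  (f zero + sumFin n (f ∘ suc)) + (g zero + sumFin n (g ∘ suc)) ≡⟨ interchange (f zero) _ (g zero) _ ⟩
  (f zero + g zero) + (sumFin n (f ∘ suc) + sumFin n (g ∘ suc)) ≤⟨ +-mono-≤ (bound zero)
                                                                     (sumFin-bound n _ _ c (bound ∘ suc)) ⟩
  c + n * c                                                      ∎
  where open ≤-Reasoning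

module Rounds {N D M : ℕ} (Disp : Fin N → Fin D → Fin M) where
  open Alg Disp

  bins : Fin D → Subset N → Subset M
  bins j = image (λ x → Disp x j)

  LeastInBin : Fin D → Subset N → Fin N → Set
  LeastInBin j S x = x ∈ S × (∀ y → y ∈ S → Disp y j ≡ Disp x j → x Fin.≤ y)

  Matched : Fin D → Subset N → Subset N → Fin N → Set
  Matched j S U x = LeastInBin j S x × Disp x j ∈ bins j U

  least-in-bin : ∀ j S {b} → b ∈ bins j S → ∃ λ x → LeastInBin j S x × Disp x j ≡ b
  least-in-bin j S {b} b∈ with ∈-image⁻ (λ x → Disp x j) b∈
  ... | _ , x∈S , e with least-witness (λ y → y ∈ S × Disp y j ≡ b)
                                        (λ y → (y ∈? S) ×-dec (Disp y j Fin.≟ b)) (x∈S , e)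
  ...   | w , (w∈S , ew) , least = w , (w∈S , λ y y∈S e′ → least (y∈S , trans e′ ew)) , ew

  matched? : Fin D → Subset N → Subset N → Fin N → Bool
  matched? j S U x = smallestInBin j S x ∧ occupied j U (Disp x j)

  matched?⇔ : ∀ j S U x → T (matched? j S U x) ⇔ Matched j S U x
  matched?⇔ j S U x = mk⇔
    (λ t → let (s , o) = to T-∧ t in toWitness s , from (∈-tabulate _) o)
    (λ { (l , o) → from T-∧ (fromWitness l , to (∈-tabulate _) o) })

  rest⇔ : ∀ j S U {x} → x ∈ restW j S U ⇔ (x ∈ S × ¬ Matched j S U x)
  rest⇔ j S U {x} = mk⇔
    (λ x∈ → let (s , m) = to T-∧ (to (∈-tabulate _) x∈)
            in toWitness s , not-T m ∘ from (matched?⇔ j S U x))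
    (λ { (x∈S , ¬m) → from (∈-tabulate _)
           (from T-∧ (fromWitness x∈S , T-not (¬m ∘ to (matched?⇔ j S U x)))) })
    where not-T : ∀ {b} → T (not b) → ¬ T b
          not-T {false} _ ()
          T-not : ∀ {b} → ¬ T b → T (not b)
          T-not {false} _  = _
          T-not {true}  ¬t = ¬t _

  rest-⊆ : ∀ j S U → restW j S U ⊆ S
  rest-⊆ j S U = proj₁ ∘ to (rest⇔ j S U)

  matched⇒removed : ∀ j S U {x} → Matched j S U x → x ∉ restW j S U
  matched⇒removed j S U m x∈ = proj₂ (to (rest⇔ j S U) x∈) m

  removed⇒matched : ∀ j S U {x} → x ∈ S ─ restW j S U → Matched j S U x
  removed⇒matched j S U {x} x∈ with T? (matched? j S U x)
  ... | yes t = to (matched?⇔ j S U x) t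
  ... | no ¬t = contradiction (from (rest⇔ j S U) (p─q⊆p S _ x∈ , ¬t ∘ from (matched?⇔ j S U x)))
                              (x∈p─q⇒x∉q S _ x∈)

  matches≡ : ∀ j S U → matches j S U ≡ ∣ bins j S ∩ bins j U ∣
  matches≡ j S U = cong ∣_∣ (tabulate-∧ M (occupied j S) (occupied j U))

  matches-sym : ∀ j S U → matches j S U ≡ matches j U S
  matches-sym j S U = begin
    matches j S U             ≡⟨ matches≡ j S U ⟩
    ∣ bins j S ∩ bins j U ∣   ≡⟨ cong ∣_∣ (∩-comm (bins j S) (bins j U)) ⟩
    ∣ bins j U ∩ bins j S ∣   ≡⟨ matches≡ j U S ⟨
    matches j U S             ∎
    where open ≡-Reasoning

  -- Round j removes at most matches j S U elements of S: removed elements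
  -- are least in their bins, so x ↦ Disp x j injects them into the shared bins.
  ∣removed∣≤matches : ∀ j S U → ∣ S ─ restW j S U ∣ ≤ matches j S U
  ∣removed∣≤matches j S U = subst (∣ S ─ restW j S U ∣ ≤_) (sym (matches≡ j S U))
    (∣S∣≤∣R∣-by-injection (λ x → Disp x j) (S ─ restW j S U) into injective)
    where
    into : ∀ {x} → x ∈ S ─ restW j S U → Disp x j ∈ bins j S ∩ bins j U
    into x∈ with removed⇒matched j S U x∈
    ... | (x∈S , _) , bin∈U = x∈p∩q⁺ (∈-image⁺ _ x∈S , bin∈U)
    injective : ∀ {x y} → x ∈ S ─ restW j S U → y ∈ S ─ restW j S U → Disp x j ≡ Disp y j → x ≡ y
    injective x∈ y∈ e with removed⇒matched j S U x∈ | removed⇒matched j S U y∈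
    ... | (x∈S , x-least) , _ | (y∈S , y-least) , _ = ≤ᶠ-antisym (x-least _ y∈S (sym e)) (y-least _ x∈S e)

  -- The workers left after running the rounds js on (W,T).  By the symmetry
  -- of Alg (restT j W T is restW j T W), the tasks left are leftover js T W.
  leftover : List (Fin D) → Subset N → Subset N → Subset N
  leftover []       W T = W
  leftover (j ∷ js) W T = leftover js (restW j W T) (restW j T W)

  leftover-⊆ : ∀ js W T → leftover js W T ⊆ W
  leftover-⊆ []       W T = λ x∈ → x∈
  leftover-⊆ (j ∷ js) W T = rest-⊆ j W T ∘ leftover-⊆ js _ _

  runSeq-sym : ∀ js W T → runSeq js W T ≡ runSeq js T W
  runSeq-sym []       W T = refl
  runSeq-sym (j ∷ js) W T = cong₂ _+_ (matches-sym j W T) (runSeq-sym js (restW j W T) (restW j T W))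

  ∣matched∣≤runSeq : ∀ js W T → ∣ W ─ leftover js W T ∣ ≤ runSeq js W T
  ∣matched∣≤runSeq []       W T = ≤-trans (p⊆q⇒∣p∣≤∣q∣ W─W⊆⊥) (≤-reflexive (∣⊥∣≡0 N))
    where W─W⊆⊥ : W ─ W ⊆ ⊥
          W─W⊆⊥ x∈ = contradiction (p─q⊆p W W x∈) (x∈p─q⇒x∉q W W x∈)
  ∣matched∣≤runSeq (j ∷ js) W T = begin
    ∣ W ─ L ∣                  ≤⟨ p⊆q⇒∣p∣≤∣q∣ (─-split W W′ L) ⟩
    ∣ (W ─ W′) ∪ (W′ ─ L) ∣    ≤⟨ ∣p∪q∣≤∣p∣+∣q∣ (W ─ W′) (W′ ─ L) ⟩
    ∣ W ─ W′ ∣ + ∣ W′ ─ L ∣    ≤⟨ +-mono-≤ (∣removed∣≤matches j W T) (∣matched∣≤runSeq js W′ (restW j T W)) ⟩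
    runSeq (j ∷ js) W T        ∎
    where open ≤-Reasoning
          W′ = restW j W T
          L  = leftover js W′ (restW j T W)

  ∣matched-tasks∣≤runSeq : ∀ js W T → ∣ T ─ leftover js T W ∣ ≤ runSeq js W T
  ∣matched-tasks∣≤runSeq js W T =
    subst (∣ T ─ leftover js T W ∣ ≤_) (sym (runSeq-sym js W T)) (∣matched∣≤runSeq js T W)

  bin-lost : ∀ j js S U {d b} → b ∈ bins d S → b ∉ bins d (restW j S U) →
             b ∈ bins d (S ─ leftover js (restW j S U) (restW j U S))
  bin-lost j js S U b∈S b∉S′ with x∈p∪q⁻ _ _ (image-─ _ S (restW j S U) b∈S)
  ... | inj₁ b∈S′ = contradiction b∈S′ b∉S′
  ... | inj₂ b∈   = image-mono _ (─-mono (λ x∈ → x∈) (leftover-⊆ js _ _)) b∈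

  cover : ∀ js W T {d} → d ∈ₗ js → ∀ {b} → b ∈ bins d W → b ∈ bins d T →
          b ∈ bins d (W ─ leftover js W T) ⊎ b ∈ bins d (T ─ leftover js T W)
  cover (d ∷ js) W T (hereₗ refl) {b} b∈W b∈T with least-in-bin d W b∈W
  ... | w , w-least , refl = inj₁ (∈-image⁺ _ (x∈p∧x∉q⇒x∈p─q (proj₁ w-least) w-gone))
    where w-gone : w ∉ leftover (d ∷ js) W T
          w-gone = matched⇒removed d W T (w-least , b∈T) ∘ leftover-⊆ js _ _
  cover (j ∷ js) W T {d} (thereₗ d∈js) {b} b∈W b∈T
    with b ∈? bins d (restW j W T) | b ∈? bins d (restW j T W)
  ... | no b∉W′ | _       = inj₁ (bin-lost j js W T b∈W b∉W′)
  ... | yes _   | no b∉T′ = inj₂ (bin-lost j js T W b∈T b∉T′)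
  ... | yes b∈W′ | yes b∈T′ with cover js (restW j W T) (restW j T W) d∈js b∈W′ b∈T′
  ...   | inj₁ b∈ = inj₁ (image-mono _ (─-mono (rest-⊆ j W T) (λ x∈ → x∈)) b∈)
  ...   | inj₂ b∈ = inj₂ (image-mono _ (─-mono (rest-⊆ j T W) (λ x∈ → x∈)) b∈)

  per-seed : ∀ W T d → ∣ bins d W ∣ + ∣ bins d T ∣ ≤ M + (assignmentsÊ W T + assignmentsÊ W T)
  per-seed W T d = begin
    ∣ bins d W ∣ + ∣ bins d T ∣          ≤⟨ ∣p∣+∣q∣≤n+∣p∩q∣ (bins d W) (bins d T) ⟩
    M + ∣ bins d W ∩ bins d T ∣          ≤⟨ +-monoʳ-≤ M (p⊆q⇒∣p∣≤∣q∣ shared-covered) ⟩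
    M + ∣ bins d RW ∪ bins d RT ∣        ≤⟨ +-monoʳ-≤ M (∣p∪q∣≤∣p∣+∣q∣ (bins d RW) (bins d RT)) ⟩
    M + (∣ bins d RW ∣ + ∣ bins d RT ∣)  ≤⟨ +-monoʳ-≤ M (+-mono-≤ (∣image∣≤ (λ x → Disp x d) RW)
                                                                (∣image∣≤ (λ x → Disp x d) RT)) ⟩
    M + (∣ RW ∣ + ∣ RT ∣)                ≤⟨ +-monoʳ-≤ M (+-mono-≤ (∣matched∣≤runSeq (allFin D) W T)
                                                                (∣matched-tasks∣≤runSeq (allFin D) W T)) ⟩
    M + (assignmentsÊ W T + assignmentsÊ W T) ∎
    where
    open ≤-Reasoning
    RW = W ─ leftover (allFin D) W T
    RT = T ─ leftover (allFin D) T W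
    shared-covered : bins d W ∩ bins d T ⊆ bins d RW ∪ bins d RT
    shared-covered b∈ = let (b∈W , b∈T) = x∈p∩q⁻ _ _ b∈
                        in x∈p∪q⁺ (cover (allFin D) W T (∈-allFin d) b∈W b∈T)

disperser-arithmetic : ∀ {D M} P Q A → 0 < D → 3 * (M * D) ≤ 4 * P → 3 * (M * D) ≤ 4 * Q →
                       P + Q ≤ D * (M + (A + A)) → M ≤ 4 * A
disperser-arithmetic {suc D′} {M} P Q A _ hP hQ hPQ =
  *-cancelˡ-≤ 2 (*-cancelˡ-≤ D (+-cancelˡ-≤ (4 * (D * M)) _ _ (begin
    4 * (D * M) + D * (2 * M)          ≡⟨ lhs-identity M D ⟩
    3 * (M * D) + 3 * (M * D)          ≤⟨ +-mono-≤ hP hQ ⟩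
    4 * P + 4 * Q                      ≡⟨ sym (*-distribˡ-+ 4 P Q) ⟩
    4 * (P + Q)                        ≤⟨ *-monoʳ-≤ 4 hPQ ⟩
    4 * (D * (M + (A + A)))            ≡⟨ rhs-identity M D A ⟩
    4 * (D * M) + D * (2 * (4 * A))    ∎)))
  where
  open ≤-Reasoning
  D = suc D′
  lhs-identity : ∀ M D → 4 * (D * M) + D * (2 * M) ≡ 3 * (M * D) + 3 * (M * D)
  lhs-identity = solve-∀
  rhs-identity : ∀ M D A → 4 * (D * (M + (A + A))) ≡ 4 * (D * M) + D * (2 * (4 * A))
  rhs-identity = solve-∀

lemma17 : (k N D M : ℕ) → 0 < N → 0 < D → 0 < M →
    (Disp : Fin N → Fin D → Fin M) → IsStrongDisperser¼ k N D M Disp →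
    (W T : Subset N) → ∣ W ∣ ≡ ∣ T ∣ → 2 ^ k ≤ ∣ W ∣ →
    M ≤ 4 * Alg.assignmentsÊ Disp W T
lemma17 k N D M _ 0<D _ Disp disperser W T ∣W∣≡∣T∣ 2^k≤∣W∣ =
  disperser-arithmetic (pairImageSize Disp W) (pairImageSize Disp T) (Alg.assignmentsÊ Disp W T) 0<D
    (disperser W 2^k≤∣W∣)
    (disperser T (subst (2 ^ k ≤_) ∣W∣≡∣T∣ 2^k≤∣W∣))
    (sumFin-bound D (λ d → ∣ bins d W ∣) (λ d → ∣ bins d T ∣) _ (per-seed W T))
  where open Rounds Disp
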